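{- For every $\{(4,2),(4,4)\}$-free $3$-graph $H$ on $n$ vertices, $e(H)\leq\binom{n-1}{2}$.
   Context: A $3$-graph is a pair $H=(V,E)$ with $E\subseteq\binom{V}{3}$, and $e(H)=|E|$. $H$ is $\{(4,2),(4,4)\}$-free if no $4$-vertex subset of $V(H)$ spans exactly $2$ or exactly $4$ edges. -}

module Defs where

open import Data.Nat using (ℕ; _+_)
open import Data.Bool using (Bool; true; false)
open import Data.Fin using (Fin; _<_)
open import Data.List using (List; []; _∷_; concatMap; allFin; length; filter; map)
open import Data.Product using (_×_; _,_)
open import Relation.Binary.PropositionalEquality using (_≡_)
open import Relation.Nullary using (¬_)
open import Data.Fin.Properties using (_<?_)
open import Relation.Nullary.Decidable using (Dec)
open import Data.Bool.Properties using (_≟_)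

-- The edge set E ⊆ (Fin n choose 3) is encoded
-- by its indicator on strictly increasing triples: the 3-set {i,j,k} with
-- i < j < k is an edge iff  edge i j k ≡ true.  Values of `edge` on
-- non-increasing triples are irrelevant (never consulted).
record ThreeGraph (n : ℕ) : Set where
  field
    edge : Fin n → Fin n → Fin n → Bool
open ThreeGraph public

b2n : Bool → ℕ
b2n true  = 1
b2n false = 0

triples : (n : ℕ) → List (Fin n × Fin n × Fin n)
triples n =
  concatMap (λ i →
    concatMap (λ j →
      map (λ k → (i , j , k)) (filter (λ k → j <? k) (allFin n)))
      (filter (λ j → i <? j) (allFin n)))
    (allFin n)

numEdges : {n : ℕ} → ThreeGraph n → ℕ
numEdges {n} H = length (filter (λ t → isEdge t ≟ true) (triples n))
  where
  isEdge : Fin n × Fin n × Fin n → Bool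
  isEdge (i , j , k) = edge H i j k

span4 : {n : ℕ} → ThreeGraph n → Fin n → Fin n → Fin n → Fin n → ℕ
span4 H a b c d =
  b2n (edge H a b c) + b2n (edge H a b d) + b2n (edge H a c d) + b2n (edge H b c d)

Free-4-2-4-4 : {n : ℕ} → ThreeGraph n → Set
Free-4-2-4-4 {n} H =
  (a b c d : Fin n) → a < b → b < c → c < d →
  ¬ (span4 H a b c d ≡ 2) × ¬ (span4 H a b c d ≡ 4)

-- Call a pair of vertices light if its codegree is 1, and give it weight n − 2 if it is light and
-- weight 1 otherwise.  Freeness says that every 4-set spans 0, 1 or 3 edges, so a 4-set spanning
-- an edge spans an odd number of them; since the five 4-subsets of a 5-set together count each of
-- its triples twice, some 4-subset of every 5-set spans no edge.  This forces every edge to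
-- contain a light pair, so the weights of the three pairs of an edge add up to at least n.
-- In Σ_{x ≠ y} d(x,y)·w(x,y) every edge contributes twice the sum of its pair weights, at least 2n,
-- while each term is at most n − 2; hence 2n·e(H) ≤ n(n − 1)(n − 2).

module Submission where

import Algebra.Properties.Semiring.Sum as ∑
open import Data.Bool using (true; false)
import Data.Bool.Properties as Bool
open import Data.Empty using (⊥; ⊥-elim)
open import Data.Fin as Fin using (Fin; zero; suc; _<_; punchIn; punchOut)
open import Data.Fin.Properties as Finₚ using (_<?_; punchInᵢ≢i; punchIn-punchOut)
open import Data.List using (List; []; _∷_; _++_; map; filter; concatMap; tabulate; allFin; length)
open import Data.List.Properties using (map-++; map-∘)
open import Data.Nat using (ℕ; zero; suc; _+_; _*_; _∸_; _≤_; z≤n; s≤s; _≟_)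
open import Data.Nat.Combinatorics using (_C_; nC1≡n; nCk+nC[k+1]≡[n+1]C[k+1])
import Data.Nat.ListAction as List
open import Data.Nat.ListAction.Properties using (sum-++)
open import Data.Nat.Properties
  using ( +-*-semiring; +-assoc; +-comm; +-identityʳ; +-mono-≤; +-monoʳ-≤; *-identityˡ; *-identityʳ
        ; *-zeroʳ; *-distribˡ-+; *-mono-≤; *-monoʳ-≤; *-cancelˡ-≤; ≤-refl; ≤-reflexive; ≤-trans; <⇒≤
        ; ≤⇒≯; ∸-monoˡ-≤; m≤n+m∸n; n≤1⇒n≡0∨n≡1; m+n≡0⇒m≡0; m+n≡0⇒n≡0; 0≢1+n; even≢odd
        ; module ≤-Reasoning )
open import Data.Nat.Tactic.RingSolver using (solve-∀)
open import Data.Product using (_×_; _,_; ∃)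
open import Data.Sum using (_⊎_; inj₁; inj₂)
open import Data.Vec.Functional using (Vector; removeAt)
open import Function using (_∘_)
open import Relation.Binary.Bundles using (TotalOrder)
open import Relation.Binary.PropositionalEquality
open import Relation.Nullary using (Dec; does; ¬_; yes; no)
open import Relation.Nullary.Decidable using (dec-true; dec-false)
open import Relation.Unary using (Pred; Decidable)

open import Defs

open ∑ +-*-semiring
  using ( sum; sum-syntax; sum-cong-≗; sum-remove; sum-replicate-zero; ∑-comm; ∑-distrib-+
        ; *-distribˡ-sum; *-distribʳ-sum )

module _ {c ℓ₁ ℓ₂} (O : TotalOrder c ℓ₁ ℓ₂) where
  open TotalOrder O using (total) renaming (Carrier to A; _≤_ to _⊑_)

  module _ {p} (P : A → A → A → Set p)
           (swap₁₂ : ∀ {x y z} → P x y z → P y x z)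
           (swap₂₃ : ∀ {x y z} → P x y z → P x z y)
           (sorted : ∀ {x y z} → x ⊑ y → y ⊑ z → P x y z) where

    private
      insert : ∀ x {y z} → y ⊑ z → P x y z
      insert x {y} {z} y≤z with total x y | total x z
      ... | inj₁ x≤y | _        = sorted x≤y y≤z
      ... | inj₂ y≤x | inj₁ x≤z = swap₁₂ (sorted y≤x x≤z)
      ... | inj₂ y≤x | inj₂ z≤x = swap₁₂ (swap₂₃ (sorted y≤z z≤x))

    wlog-sorted₃ : ∀ x y z → P x y z
    wlog-sorted₃ x y z with total y z
    ... | inj₁ y≤z = insert x y≤z
    ... | inj₂ z≤y = swap₂₃ (insert x z≤y)

  module _ {p} (P : A → A → A → A → Set p)
           (swap₁₂ : ∀ {w x y z} → P w x y z → P x w y z)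
           (swap₂₃ : ∀ {w x y z} → P w x y z → P w y x z)
           (swap₃₄ : ∀ {w x y z} → P w x y z → P w x z y)
           (sorted : ∀ {w x y z} → w ⊑ x → x ⊑ y → y ⊑ z → P w x y z) where

    private
      insert : ∀ w {x y z} → x ⊑ y → y ⊑ z → P w x y z
      insert w {x} {y} {z} x≤y y≤z with total w x | total w y | total w z
      ... | inj₁ w≤x | _        | _        = sorted w≤x x≤y y≤z
      ... | inj₂ x≤w | inj₁ w≤y | _        = swap₁₂ (sorted x≤w w≤y y≤z)
      ... | inj₂ x≤w | inj₂ y≤w | inj₁ w≤z = swap₁₂ (swap₂₃ (sorted x≤y y≤w w≤z))
      ... | inj₂ x≤w | inj₂ y≤w | inj₂ z≤w = swap₁₂ (swap₂₃ (swap₃₄ (sorted x≤y y≤z z≤w)))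

    wlog-sorted₄ : ∀ w x y z → P w x y z
    wlog-sorted₄ w x y z =
      wlog-sorted₃ (λ x y z → ∀ w → P w x y z)
        (λ p w → swap₂₃ (p w)) (λ p w → swap₃₄ (p w)) (λ x≤y y≤z w → insert w x≤y y≤z)
        x y z w

𝟙[_] : ∀ {p} {P : Set p} → Dec P → ℕ
𝟙[ d ] = b2n (does d)

𝟙-yes : ∀ {p} {P : Set p} (d : Dec P) → P → 𝟙[ d ] ≡ 1
𝟙-yes d p = cong b2n (dec-true d p)

𝟙-no : ∀ {p} {P : Set p} (d : Dec P) → ¬ P → 𝟙[ d ] ≡ 0
𝟙-no d ¬p = cong b2n (dec-false d ¬p)

b2n≤1 : ∀ b → b2n b ≤ 1
b2n≤1 true  = s≤s z≤n
b2n≤1 false = z≤n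

𝟙≤1 : ∀ {p} {P : Set p} (d : Dec P) → 𝟙[ d ] ≤ 1
𝟙≤1 d = b2n≤1 (does d)

𝟙[≟true] : ∀ b → 𝟙[ b Bool.≟ true ] ≡ b2n b
𝟙[≟true] true  = refl
𝟙[≟true] false = refl

𝟙*≢0⇒ : ∀ {p} {P : Set p} (d : Dec P) {m} → 𝟙[ d ] * m ≢ 0 → P
𝟙*≢0⇒ (yes p) _ = p
𝟙*≢0⇒ (no _)  h = ⊥-elim (h refl)

∑-mono-≤ : ∀ {n} {f g : Vector ℕ n} → (∀ i → f i ≤ g i) → sum f ≤ sum g
∑-mono-≤ {zero}  f≤g = z≤n
∑-mono-≤ {suc n} f≤g = +-mono-≤ (f≤g zero) (∑-mono-≤ (f≤g ∘ suc))

∑-≤ : ∀ {n c} (f : Vector ℕ n) → (∀ i → f i ≤ c) → sum f ≤ n * c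
∑-≤ {zero}  f f≤c = z≤n
∑-≤ {suc n} f f≤c = +-mono-≤ (f≤c zero) (∑-≤ (f ∘ suc) (f≤c ∘ suc))

∑-≤-punctured : ∀ {n c} (f : Vector ℕ n) {i} → f i ≡ 0 → (∀ j → f j ≤ c) → sum f ≤ (n ∸ 1) * c
∑-≤-punctured {suc n} {c} f {i} fi≡0 f≤c = begin
  sum f                      ≡⟨ sum-remove {i = i} f ⟩
  f i + sum (removeAt f i)   ≡⟨ cong (_+ sum (removeAt f i)) fi≡0 ⟩
  sum (removeAt f i)         ≤⟨ ∑-≤ (removeAt f i) (f≤c ∘ punchIn i) ⟩
  n * c                      ∎
  where open ≤-Reasoning

∑-≤-punctured₂ : ∀ {n c} (f : Vector ℕ n) {i j} → i ≢ j → f i ≡ 0 → f j ≡ 0 →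
                 (∀ k → f k ≤ c) → sum f ≤ (n ∸ 2) * c
∑-≤-punctured₂ {suc n} {c} f {i} {j} i≢j fi≡0 fj≡0 f≤c = begin
  sum f                      ≡⟨ sum-remove {i = i} f ⟩
  f i + sum (removeAt f i)   ≡⟨ cong (_+ sum (removeAt f i)) fi≡0 ⟩
  sum (removeAt f i)         ≤⟨ ∑-≤-punctured (removeAt f i) fj≡0′ (f≤c ∘ punchIn i) ⟩
  (n ∸ 1) * c                ∎
  where
  open ≤-Reasoning
  fj≡0′ : removeAt f i (punchOut i≢j) ≡ 0
  fj≡0′ = trans (cong f (punchIn-punchOut i≢j)) fj≡0

nonzero-term : ∀ {n} (f : Vector ℕ n) → sum f ≢ 0 → ∃ λ i → f i ≢ 0
nonzero-term {zero}  f ∑f≢0 = ⊥-elim (∑f≢0 refl)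
nonzero-term {suc n} f ∑f≢0 with f zero ≟ 0
... | no  f₀≢0 = zero , f₀≢0
... | yes f₀≡0 with nonzero-term (f ∘ suc) (λ ∑≡0 → ∑f≢0 (cong₂ _+_ f₀≡0 ∑≡0))
...   | i , fi≢0 = suc i , fi≢0

nonzero-term-except : ∀ {n} (f : Vector ℕ n) k → sum f ≢ f k → ∃ λ i → i ≢ k × f i ≢ 0
nonzero-term-except {suc n} f k ∑f≢fk with nonzero-term (removeAt f k) rest≢0
  where
  rest≢0 : sum (removeAt f k) ≢ 0
  rest≢0 rest≡0 = ∑f≢fk (trans (sum-remove {i = k} f) (trans (cong (f k +_) rest≡0) (+-identityʳ (f k))))
... | i , fi≢0 = punchIn k i , punchInᵢ≢i k i , fi≢0

symmetrize : ∀ {a} {A : Set a} → (A → A → A → ℕ) → A → A → A → ℕ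
symmetrize f x y z = f x y z + f x z y + f y x z + f y z x + f z x y + f z y x

module _ {a} {A : Set a} (f : A → A → A → ℕ) where

  symmetrize-swap₁₂ : ∀ x y z → symmetrize f x y z ≡ symmetrize f y x z
  symmetrize-swap₁₂ x y z = permute (f x y z) (f x z y) (f y x z) (f y z x) (f z x y) (f z y x)
    where
    permute : ∀ a b c d e f → a + b + c + d + e + f ≡ c + d + a + b + f + e
    permute = solve-∀

  symmetrize-swap₂₃ : ∀ x y z → symmetrize f x y z ≡ symmetrize f x z y
  symmetrize-swap₂₃ x y z = permute (f x y z) (f x z y) (f y x z) (f y z x) (f z x y) (f z y x)
    where
    permute : ∀ a b c d e f → a + b + c + d + e + f ≡ b + a + e + f + c + d
    permute = solve-∀

+-cong₆ : ∀ {a₁ a₂ a₃ a₄ a₅ a₆ b₁ b₂ b₃ b₄ b₅ b₆ : ℕ} →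
  a₁ ≡ b₁ → a₂ ≡ b₂ → a₃ ≡ b₃ → a₄ ≡ b₄ → a₅ ≡ b₅ → a₆ ≡ b₆ →
  a₁ + a₂ + a₃ + a₄ + a₅ + a₆ ≡ b₁ + b₂ + b₃ + b₄ + b₅ + b₆
+-cong₆ refl refl refl refl refl refl = refl

+-zeros₅ : ∀ {m a b c d e} → a ≡ 0 → b ≡ 0 → c ≡ 0 → d ≡ 0 → e ≡ 0 → m + a + b + c + d + e ≡ m
+-zeros₅ {m} refl refl refl refl refl
  rewrite +-identityʳ m | +-identityʳ m | +-identityʳ m | +-identityʳ m | +-identityʳ m = refl

symmetrize-sym₂ : ∀ {a} {A : Set a} (g : A → A → ℕ) → (∀ x y → g x y ≡ g y x) →
                  ∀ x y z → symmetrize (λ x y _ → g x y) x y z ≡ 2 * (g x y + g x z + g y z)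
symmetrize-sym₂ g g-sym x y z rewrite g-sym y x | g-sym z x | g-sym z y = twice (g x y) (g x z) (g y z)
  where
  twice : ∀ a b c → a + b + a + c + b + c ≡ 2 * (a + b + c)
  twice = solve-∀

module _ {n : ℕ} where

  ∑³ : (Fin n → Fin n → Fin n → ℕ) → ℕ
  ∑³ f = ∑[ x < n ] ∑[ y < n ] ∑[ z < n ] f x y z

  ∑³-cong : ∀ {f g : Fin n → Fin n → Fin n → ℕ} → (∀ x y z → f x y z ≡ g x y z) → ∑³ f ≡ ∑³ g
  ∑³-cong f≡g = sum-cong-≗ λ x → sum-cong-≗ λ y → sum-cong-≗ (f≡g x y)

  ∑³-mono-≤ : ∀ {f g : Fin n → Fin n → Fin n → ℕ} → (∀ x y z → f x y z ≤ g x y z) → ∑³ f ≤ ∑³ g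
  ∑³-mono-≤ f≤g = ∑-mono-≤ λ x → ∑-mono-≤ λ y → ∑-mono-≤ (f≤g x y)

  ∑³-distrib-+ : ∀ f g → ∑³ (λ x y z → f x y z + g x y z) ≡ ∑³ f + ∑³ g
  ∑³-distrib-+ f g =
    trans (sum-cong-≗ λ x → trans (sum-cong-≗ λ y → ∑-distrib-+ (f x y) (g x y))
                                  (∑-distrib-+ (λ y → ∑[ z < n ] f x y z) (λ y → ∑[ z < n ] g x y z)))
          (∑-distrib-+ (λ x → ∑[ y < n ] ∑[ z < n ] f x y z) (λ x → ∑[ y < n ] ∑[ z < n ] g x y z))

  ∑³-*ʳ : ∀ f c → ∑³ f * c ≡ ∑³ (λ x y z → f x y z * c)
  ∑³-*ʳ f c = trans (*-distribʳ-sum c (λ x → ∑[ y < n ] ∑[ z < n ] f x y z))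
    (sum-cong-≗ λ x → trans (*-distribʳ-sum c (λ y → ∑[ z < n ] f x y z)) (sum-cong-≗ λ y → *-distribʳ-sum c (f x y)))

  ∑³-swap₁₂ : ∀ f → ∑³ f ≡ ∑³ (λ x y z → f y x z)
  ∑³-swap₁₂ f = ∑-comm (λ x y → ∑[ z < n ] f x y z)

  ∑³-swap₂₃ : ∀ f → ∑³ f ≡ ∑³ (λ x y z → f x z y)
  ∑³-swap₂₃ f = sum-cong-≗ λ x → ∑-comm (f x)

  ∑³-distrib-+₆ : ∀ f₁ f₂ f₃ f₄ f₅ f₆ →
    ∑³ (λ x y z → f₁ x y z + f₂ x y z + f₃ x y z + f₄ x y z + f₅ x y z + f₆ x y z) ≡
    ∑³ f₁ + ∑³ f₂ + ∑³ f₃ + ∑³ f₄ + ∑³ f₅ + ∑³ f₆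
  ∑³-distrib-+₆ f₁ f₂ f₃ f₄ f₅ f₆ =
    trans (∑³-distrib-+ _ f₆) (cong (_+ ∑³ f₆)
    (trans (∑³-distrib-+ _ f₅) (cong (_+ ∑³ f₅)
    (trans (∑³-distrib-+ _ f₄) (cong (_+ ∑³ f₄)
    (trans (∑³-distrib-+ _ f₃) (cong (_+ ∑³ f₃)
    (∑³-distrib-+ f₁ f₂))))))))

  -- Each of the six terms is moved onto t x y z by relabelling the summation variables.
  ∑³-symmetrize-* : ∀ (t h : Fin n → Fin n → Fin n → ℕ) →
    ∑³ (λ x y z → symmetrize t x y z * h x y z) ≡ ∑³ (λ x y z → t x y z * symmetrize h x y z)
  ∑³-symmetrize-* t h =
    trans (∑³-cong λ x y z → *-distribʳ-+₆ (t x y z) (t x z y) (t y x z) (t y z x) (t z x y) (t z y x) (h x y z))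
    (trans (∑³-distrib-+₆ (λ x y z → t x y z * h x y z) (λ x y z → t x z y * h x y z)
                          (λ x y z → t y x z * h x y z) (λ x y z → t y z x * h x y z)
                          (λ x y z → t z x y * h x y z) (λ x y z → t z y x * h x y z))
    (trans (+-cong₆ refl (∑³-swap₂₃ _) (∑³-swap₁₂ _)
                    (trans (∑³-swap₁₂ _) (∑³-swap₂₃ _))
                    (trans (∑³-swap₂₃ _) (∑³-swap₁₂ _))
                    (trans (∑³-swap₁₂ _) (trans (∑³-swap₂₃ _) (∑³-swap₁₂ _))))
    (trans (sym (∑³-distrib-+₆ _ _ _ _ _ _))
    (∑³-cong λ x y z → *-distribˡ-+₆ (t x y z) (h x y z) (h x z y) (h y x z) (h y z x) (h z x y) (h z y x)))))
    where
    *-distribʳ-+₆ : ∀ a b c d e f g → (a + b + c + d + e + f) * g ≡ a * g + b * g + c * g + d * g + e * g + f * g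
    *-distribʳ-+₆ = solve-∀
    *-distribˡ-+₆ : ∀ t a b c d e f → t * a + t * b + t * c + t * e + t * d + t * f ≡ t * (a + b + c + d + e + f)
    *-distribˡ-+₆ = solve-∀

module _ {a} {A : Set a} where

  length-filter≡∑𝟙 : ∀ {p} {P : Pred A p} (P? : Decidable P) xs →
    length (filter P? xs) ≡ List.sum (map (λ x → 𝟙[ P? x ]) xs)
  length-filter≡∑𝟙 P? [] = refl
  length-filter≡∑𝟙 P? (x ∷ xs) with does (P? x)
  ... | true  = cong suc (length-filter≡∑𝟙 P? xs)
  ... | false = length-filter≡∑𝟙 P? xs

  ∑-map-filter : ∀ {p} {P : Pred A p} (P? : Decidable P) (f : A → ℕ) xs →
    List.sum (map f (filter P? xs)) ≡ List.sum (map (λ x → 𝟙[ P? x ] * f x) xs)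
  ∑-map-filter P? f [] = refl
  ∑-map-filter P? f (x ∷ xs) with does (P? x)
  ... | true  = cong₂ _+_ (sym (+-identityʳ (f x))) (∑-map-filter P? f xs)
  ... | false = ∑-map-filter P? f xs

  ∑-map-tabulate : ∀ {n} (f : A → ℕ) (g : Fin n → A) → List.sum (map f (tabulate g)) ≡ ∑[ i < n ] f (g i)
  ∑-map-tabulate {zero}  f g = refl
  ∑-map-tabulate {suc n} f g = cong (f (g zero) +_) (∑-map-tabulate f (g ∘ suc))

  ∑-map-concatMap : ∀ {b} {B : Set b} (f : B → ℕ) (g : A → List B) xs →
    List.sum (map f (concatMap g xs)) ≡ List.sum (map (λ x → List.sum (map f (g x))) xs)
  ∑-map-concatMap f g [] = refl
  ∑-map-concatMap f g (x ∷ xs) = begin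
    List.sum (map f (g x ++ concatMap g xs))                   ≡⟨ cong List.sum (map-++ f (g x) (concatMap g xs)) ⟩
    List.sum (map f (g x) ++ map f (concatMap g xs))           ≡⟨ sum-++ (map f (g x)) (map f (concatMap g xs)) ⟩
    List.sum (map f (g x)) + List.sum (map f (concatMap g xs))
      ≡⟨ cong (List.sum (map f (g x)) +_) (∑-map-concatMap f g xs) ⟩
    List.sum (map f (g x)) + List.sum (map (λ x → List.sum (map f (g x))) xs) ∎
    where open ≡-Reasoning


∑-filter-allFin : ∀ {n p} {P : Pred (Fin n) p} (P? : Decidable P) (f : Fin n → ℕ) →
  List.sum (map f (filter P? (allFin n))) ≡ ∑[ i < n ] (𝟙[ P? i ] * f i)
∑-filter-allFin {n} P? f = trans (∑-map-filter P? f (allFin n)) (∑-map-tabulate (λ i → 𝟙[ P? i ] * f i) (λ i → i))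

∑-triples : ∀ {n} (f : Fin n × Fin n × Fin n → ℕ) →
  List.sum (map f (triples n)) ≡ ∑³ (λ i j k → 𝟙[ i <? j ] * (𝟙[ j <? k ] * f (i , j , k)))
∑-triples {n} f = begin
  List.sum (map f (concatMap pairsFrom (allFin n)))                    ≡⟨ ∑-map-concatMap f pairsFrom (allFin n) ⟩
  List.sum (map (λ i → List.sum (map f (pairsFrom i))) (allFin n))
    ≡⟨ ∑-map-tabulate (λ i → List.sum (map f (pairsFrom i))) (λ i → i) ⟩
  ∑[ i < n ] List.sum (map f (pairsFrom i))                            ≡⟨ sum-cong-≗ ∑-pairsFrom ⟩
  ∑³ (λ i j k → 𝟙[ i <? j ] * (𝟙[ j <? k ] * f (i , j , k)))           ∎
  where
  open ≡-Reasoning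

  triplesFrom : Fin n → Fin n → List (Fin n × Fin n × Fin n)
  triplesFrom i j = map (λ k → (i , j , k)) (filter (j <?_) (allFin n))

  pairsFrom : Fin n → List (Fin n × Fin n × Fin n)
  pairsFrom i = concatMap (triplesFrom i) (filter (i <?_) (allFin n))

  ∑-triplesFrom : ∀ i j → List.sum (map f (triplesFrom i j)) ≡ ∑[ k < n ] (𝟙[ j <? k ] * f (i , j , k))
  ∑-triplesFrom i j = trans (cong List.sum (sym (map-∘ (filter (j <?_) (allFin n)))))
                            (∑-filter-allFin (j <?_) (λ k → f (i , j , k)))

  ∑-pairsFrom : ∀ i → List.sum (map f (pairsFrom i)) ≡
                      ∑[ j < n ] ∑[ k < n ] (𝟙[ i <? j ] * (𝟙[ j <? k ] * f (i , j , k)))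
  ∑-pairsFrom i = begin
    List.sum (map f (concatMap (triplesFrom i) (filter (i <?_) (allFin n))))
      ≡⟨ ∑-map-concatMap f (triplesFrom i) (filter (i <?_) (allFin n)) ⟩
    List.sum (map (λ j → List.sum (map f (triplesFrom i j))) (filter (i <?_) (allFin n)))
      ≡⟨ ∑-filter-allFin (i <?_) (λ j → List.sum (map f (triplesFrom i j))) ⟩
    ∑[ j < n ] (𝟙[ i <? j ] * List.sum (map f (triplesFrom i j)))
      ≡⟨ sum-cong-≗ (λ j → cong (𝟙[ i <? j ] *_) (∑-triplesFrom i j)) ⟩
    ∑[ j < n ] (𝟙[ i <? j ] * ∑[ k < n ] (𝟙[ j <? k ] * f (i , j , k)))
      ≡⟨ sum-cong-≗ (λ j → *-distribˡ-sum 𝟙[ i <? j ] (λ k → 𝟙[ j <? k ] * f (i , j , k))) ⟩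
    ∑[ j < n ] ∑[ k < n ] (𝟙[ i <? j ] * (𝟙[ j <? k ] * f (i , j , k))) ∎

Distinct₃ : ∀ {a} {A : Set a} → A → A → A → Set a
Distinct₃ x y z = x ≢ y × x ≢ z × y ≢ z

Distinct₄ : ∀ {a} {A : Set a} → A → A → A → A → Set a
Distinct₄ w x y z = w ≢ x × w ≢ y × w ≢ z × x ≢ y × x ≢ z × y ≢ z

Distinct₅ : ∀ {a} {A : Set a} → A → A → A → A → A → Set a
Distinct₅ v w x y z = v ≢ w × v ≢ x × v ≢ y × v ≢ z × w ≢ x × w ≢ y × w ≢ z × x ≢ y × x ≢ z × y ≢ z

Allowed : ℕ → Set
Allowed m = ¬ m ≡ 2 × ¬ m ≡ 4

Odd : ℕ → Set
Odd m = ∃ λ t → m ≡ suc (2 * t)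

allowed⇒odd : ∀ {m} → m ≤ 4 → m ≢ 0 → Allowed m → Odd m
allowed⇒odd {0}                 _ m≢0 _          = ⊥-elim (m≢0 refl)
allowed⇒odd {1}                 _ _   _          = 0 , refl
allowed⇒odd {2}                 _ _   (m≢2 , _)  = ⊥-elim (m≢2 refl)
allowed⇒odd {3}                 _ _   _          = 1 , refl
allowed⇒odd {4}                 _ _   (_ , m≢4)  = ⊥-elim (m≢4 refl)
allowed⇒odd {suc (suc (suc (suc (suc _))))} (s≤s (s≤s (s≤s (s≤s ())))) _ _

odd-sum₅ : ∀ {m₁ m₂ m₃ m₄ m₅} → Odd m₁ → Odd m₂ → Odd m₃ → Odd m₄ → Odd m₅ → Odd (m₁ + m₂ + m₃ + m₄ + m₅)
odd-sum₅ (t₁ , refl) (t₂ , refl) (t₃ , refl) (t₄ , refl) (t₅ , refl) =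
  2 + t₁ + t₂ + t₃ + t₄ + t₅ , regroup t₁ t₂ t₃ t₄ t₅
  where
  regroup : ∀ a b c d e → suc (2 * a) + suc (2 * b) + suc (2 * c) + suc (2 * d) + suc (2 * e) ≡
                          suc (2 * (2 + a + b + c + d + e))
  regroup = solve-∀

weight : ℕ → ℕ → ℕ
weight n 1 = n ∸ 2
weight n _ = 1

*-weight-≤ : ∀ n c → c ≤ n ∸ 2 → c * weight n c ≤ n ∸ 2
*-weight-≤ n zero                _   = z≤n
*-weight-≤ n (suc zero)          _   = ≤-reflexive (+-identityʳ (n ∸ 2))
*-weight-≤ n c@(suc (suc _)) c≤n∸2 = subst (_≤ n ∸ 2) (sym (*-identityʳ c)) c≤n∸2

weight≥1 : ∀ {n} → 3 ≤ n → ∀ c → 1 ≤ weight n c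
weight≥1 3≤n zero                = ≤-refl
weight≥1 3≤n (suc zero)          = ∸-monoˡ-≤ 2 3≤n
weight≥1 3≤n (suc (suc _))       = ≤-refl

weight-sum-≥ : ∀ {n c₁ c₂ c₃} → 3 ≤ n → c₁ ≡ 1 ⊎ c₂ ≡ 1 ⊎ c₃ ≡ 1 →
               n ≤ weight n c₁ + weight n c₂ + weight n c₃
weight-sum-≥ {n} {c₂ = c₂} {c₃} 3≤n (inj₁ refl) = begin
  n                                     ≤⟨ m≤n+m∸n n 2 ⟩
  2 + (n ∸ 2)                           ≡⟨ +-comm 2 (n ∸ 2) ⟩
  n ∸ 2 + 2                             ≡⟨ +-assoc (n ∸ 2) 1 1 ⟨
  n ∸ 2 + 1 + 1                         ≤⟨ +-mono-≤ (+-monoʳ-≤ (n ∸ 2) (weight≥1 3≤n c₂)) (weight≥1 3≤n c₃) ⟩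
  n ∸ 2 + weight n c₂ + weight n c₃     ∎
  where open ≤-Reasoning
weight-sum-≥ {n} {c₁} {c₂} {c₃} 3≤n (inj₂ (inj₁ refl)) = begin
  n                                     ≤⟨ weight-sum-≥ {c₂ = c₁} {c₃} 3≤n (inj₁ refl) ⟩
  n ∸ 2 + weight n c₁ + weight n c₃     ≡⟨ cong (_+ weight n c₃) (+-comm (n ∸ 2) (weight n c₁)) ⟩
  weight n c₁ + (n ∸ 2) + weight n c₃   ∎
  where open ≤-Reasoning
weight-sum-≥ {n} {c₁} {c₂} {c₃} 3≤n (inj₂ (inj₂ refl)) = begin
  n                                     ≤⟨ weight-sum-≥ {c₂ = c₁} {c₂} 3≤n (inj₁ refl) ⟩
  n ∸ 2 + weight n c₁ + weight n c₂     ≡⟨ rotate (n ∸ 2) (weight n c₁) (weight n c₂) ⟩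
  weight n c₁ + weight n c₂ + (n ∸ 2)   ∎
  where
  open ≤-Reasoning
  rotate : ∀ a b c → a + b + c ≡ b + c + a
  rotate = solve-∀

2*[nC2]≡n*[n∸1] : ∀ n → 2 * (n C 2) ≡ n * (n ∸ 1)
2*[nC2]≡n*[n∸1] zero    = refl
2*[nC2]≡n*[n∸1] (suc n) = begin
  2 * (suc n C 2)       ≡⟨ cong (2 *_) (sym (nCk+nC[k+1]≡[n+1]C[k+1] n 1)) ⟩
  2 * (n C 1 + n C 2)   ≡⟨ cong (λ c → 2 * (c + n C 2)) (nC1≡n n) ⟩
  2 * (n + n C 2)       ≡⟨ *-distribˡ-+ 2 n (n C 2) ⟩
  2 * n + 2 * (n C 2)   ≡⟨ cong (2 * n +_) (2*[nC2]≡n*[n∸1] n) ⟩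
  2 * n + n * (n ∸ 1)   ≡⟨ step n ⟩
  suc n * n             ∎
  where
  open ≡-Reasoning
  step : ∀ n → 2 * n + n * (n ∸ 1) ≡ suc n * n
  step zero    = refl
  step (suc n) = expand n
    where
    expand : ∀ n → 2 * suc n + suc n * n ≡ suc (suc n) * suc n
    expand = solve-∀

<-<⇒3≤n : ∀ {n} {x y z : Fin n} → x < y → y < z → 3 ≤ n
<-<⇒3≤n {z = z} x<y y<z = ≤-trans (s≤s (s≤s (s≤s z≤n))) (≤-trans (s≤s (s≤s x<y)) (≤-trans (s≤s y<z) (Finₚ.toℕ<n z)))

module _ {n : ℕ} (H : ThreeGraph n) where

  sortedEdge : Fin n → Fin n → Fin n → ℕ
  sortedEdge x y z = 𝟙[ x <? y ] * (𝟙[ y <? z ] * b2n (edge H x y z))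

  -- adj x y z is 1 if {x, y, z} is an edge on three distinct vertices, and 0 otherwise.
  opaque
    adj : Fin n → Fin n → Fin n → ℕ
    adj = symmetrize sortedEdge

  codegree : Fin n → Fin n → ℕ
  codegree x y = ∑[ z < n ] adj x y z

  span : Fin n → Fin n → Fin n → Fin n → ℕ
  span w x y z = adj w x y + adj w x z + adj w y z + adj x y z

  numEdges≡∑³sortedEdge : numEdges H ≡ ∑³ sortedEdge
  numEdges≡∑³sortedEdge =
    trans (length-filter≡∑𝟙 _ (triples n)) (trans (∑-triples {n} _) (∑³-cong {n} λ x y z →
      cong (λ e → 𝟙[ x <? y ] * (𝟙[ y <? z ] * e)) (𝟙[≟true] (edge H x y z))))

  sortedEdge≤1 : ∀ x y z → sortedEdge x y z ≤ 1
  sortedEdge≤1 x y z = *-mono-≤ (𝟙≤1 (x <? y)) (*-mono-≤ (𝟙≤1 (y <? z)) (b2n≤1 (edge H x y z)))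

  sortedEdge≢0⇒sorted : ∀ {x y z} → sortedEdge x y z ≢ 0 → x < y × y < z
  sortedEdge≢0⇒sorted {x} {y} {z} h =
    𝟙*≢0⇒ (x <? y) h , 𝟙*≢0⇒ (y <? z) (λ eq → h (trans (cong (𝟙[ x <? y ] *_) eq) (*-zeroʳ 𝟙[ x <? y ])))

  sortedEdge-sorted : ∀ {x y z} → x < y → y < z → sortedEdge x y z ≡ b2n (edge H x y z)
  sortedEdge-sorted {x} {y} {z} x<y y<z
    rewrite 𝟙-yes (x <? y) x<y | 𝟙-yes (y <? z) y<z = trans (*-identityˡ _) (*-identityˡ _)

  sortedEdge-unsorted₁ : ∀ {x y} z → ¬ x < y → sortedEdge x y z ≡ 0
  sortedEdge-unsorted₁ {x} {y} z x≮y = cong (_* (𝟙[ y <? z ] * b2n (edge H x y z))) (𝟙-no (x <? y) x≮y)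

  sortedEdge-unsorted₂ : ∀ x {y z} → ¬ y < z → sortedEdge x y z ≡ 0
  sortedEdge-unsorted₂ x {y} {z} y≮z =
    trans (cong (λ c → 𝟙[ x <? y ] * (c * b2n (edge H x y z))) (𝟙-no (y <? z) y≮z)) (*-zeroʳ 𝟙[ x <? y ])

  opaque
    unfolding adj

    adj-swap₁₂ : ∀ x y z → adj x y z ≡ adj y x z
    adj-swap₁₂ = symmetrize-swap₁₂ sortedEdge

    adj-swap₂₃ : ∀ x y z → adj x y z ≡ adj x z y
    adj-swap₂₃ = symmetrize-swap₂₃ sortedEdge

    adj-weakly-sorted : ∀ {x y z} → x Fin.≤ y → y Fin.≤ z → adj x y z ≡ sortedEdge x y z
    adj-weakly-sorted {x} {y} {z} x≤y y≤z = +-zeros₅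
      (sortedEdge-unsorted₂ x (≤⇒≯ y≤z)) (sortedEdge-unsorted₁ z (≤⇒≯ x≤y)) (sortedEdge-unsorted₂ y (≤⇒≯ x≤z))
      (sortedEdge-unsorted₁ y (≤⇒≯ x≤z)) (sortedEdge-unsorted₁ x (≤⇒≯ y≤z))
      where
      x≤z : x Fin.≤ z
      x≤z = ≤-trans x≤y y≤z

  adj-sorted : ∀ {x y z} → x < y → y < z → adj x y z ≡ b2n (edge H x y z)
  adj-sorted x<y y<z = trans (adj-weakly-sorted (<⇒≤ x<y) (<⇒≤ y<z)) (sortedEdge-sorted x<y y<z)

  adj≤1 : ∀ x y z → adj x y z ≤ 1
  adj≤1 = wlog-sorted₃ (Finₚ.≤-totalOrder n) (λ x y z → adj x y z ≤ 1)
    (λ {x} {y} {z} → subst (_≤ 1) (adj-swap₁₂ x y z))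
    (λ {x} {y} {z} → subst (_≤ 1) (adj-swap₂₃ x y z))
    (λ {x} {y} {z} x≤y y≤z → subst (_≤ 1) (sym (adj-weakly-sorted x≤y y≤z)) (sortedEdge≤1 x y z))

  adj≢0⇒distinct : ∀ x y z → adj x y z ≢ 0 → Distinct₃ x y z
  adj≢0⇒distinct = wlog-sorted₃ (Finₚ.≤-totalOrder n) (λ x y z → adj x y z ≢ 0 → Distinct₃ x y z)
    (λ {x} {y} {z} p yxz≢0 → let x≢y , x≢z , y≢z = p (yxz≢0 ∘ trans (sym (adj-swap₁₂ x y z)))
                             in ≢-sym x≢y , y≢z , x≢z)
    (λ {x} {y} {z} p xzy≢0 → let x≢y , x≢z , y≢z = p (xzy≢0 ∘ trans (sym (adj-swap₂₃ x y z)))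
                             in x≢z , x≢y , ≢-sym y≢z)
    (λ {x} {y} {z} x≤y y≤z xyz≢0 →
       let x<y , y<z = sortedEdge≢0⇒sorted (xyz≢0 ∘ trans (adj-weakly-sorted x≤y y≤z))
       in Finₚ.<⇒≢ x<y , Finₚ.<⇒≢ (Finₚ.<-trans x<y y<z) , Finₚ.<⇒≢ y<z)

  adj≡0⊎adj≡1 : ∀ x y z → adj x y z ≡ 0 ⊎ adj x y z ≡ 1
  adj≡0⊎adj≡1 x y z = n≤1⇒n≡0∨n≡1 (adj≤1 x y z)

  adj≢0⇒adj≡1 : ∀ {x y z} → adj x y z ≢ 0 → adj x y z ≡ 1
  adj≢0⇒adj≡1 {x} {y} {z} xyz≢0 with adj≡0⊎adj≡1 x y z
  ... | inj₁ xyz≡0 = ⊥-elim (xyz≢0 xyz≡0)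
  ... | inj₂ xyz≡1 = xyz≡1

  adj≡1⇒distinct : ∀ {x y z} → adj x y z ≡ 1 → Distinct₃ x y z
  adj≡1⇒distinct {x} {y} {z} xyz≡1 = adj≢0⇒distinct x y z (λ xyz≡0 → 0≢1+n (trans (sym xyz≡0) xyz≡1))

  adj-nondistinct : ∀ {x y z} → ¬ Distinct₃ x y z → adj x y z ≡ 0
  adj-nondistinct {x} {y} {z} ¬distinct with adj x y z ≟ 0
  ... | yes xyz≡0 = xyz≡0
  ... | no  xyz≢0 = ⊥-elim (¬distinct (adj≢0⇒distinct x y z xyz≢0))

  codegree-sym : ∀ x y → codegree x y ≡ codegree y x
  codegree-sym x y = sum-cong-≗ (adj-swap₁₂ x y)

  codegree-refl : ∀ x → codegree x x ≡ 0
  codegree-refl x = trans (sum-cong-≗ λ z → adj-nondistinct {x} {x} {z} λ (x≢x , _) → x≢x refl) (sum-replicate-zero n)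

  codegree≤n∸2 : ∀ x y → codegree x y ≤ n ∸ 2
  codegree≤n∸2 x y with x Finₚ.≟ y
  ... | yes refl = ≤-trans (≤-reflexive (codegree-refl x)) z≤n
  ... | no  x≢y  = subst (codegree x y ≤_) (*-identityʳ (n ∸ 2))
    (∑-≤-punctured₂ (adj x y) x≢y (adj-nondistinct λ (_ , x≢x , _) → x≢x refl)
                                  (adj-nondistinct λ (_ , _ , y≢y) → y≢y refl) (adj≤1 x y))

  other-neighbour : ∀ {x y z} → codegree x y ≢ 1 → adj x y z ≡ 1 → ∃ λ w → w ≢ z × adj x y w ≡ 1
  other-neighbour {x} {y} {z} xy≢1 xyz≡1 with nonzero-term-except (adj x y) z (λ eq → xy≢1 (trans eq xyz≡1))
  ... | w , w≢z , xyw≢0 = w , w≢z , adj≢0⇒adj≡1 xyw≢0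

  span≤4 : ∀ w x y z → span w x y z ≤ 4
  span≤4 w x y z = +-mono-≤ (+-mono-≤ (+-mono-≤ (adj≤1 w x y) (adj≤1 w x z)) (adj≤1 w y z)) (adj≤1 x y z)

  span-values : ∀ w x y z {a b c d} → adj w x y ≡ a → adj w x z ≡ b → adj w y z ≡ c → adj x y z ≡ d →
                span w x y z ≡ a + b + c + d
  span-values _ _ _ _ refl refl refl refl = refl

  span-sorted : ∀ {w x y z} → w < x → x < y → y < z → span w x y z ≡ span4 H w x y z
  span-sorted {w} {x} {y} {z} w<x x<y y<z =
    span-values w x y z (adj-sorted w<x x<y) (adj-sorted w<x x<z) (adj-sorted w<y y<z) (adj-sorted x<y y<z)
    where
    x<z : x < z
    x<z = Finₚ.<-trans x<y y<z
    w<y : w < y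
    w<y = Finₚ.<-trans w<x x<y

  span-swap₁₂ : ∀ w x y z → span w x y z ≡ span x w y z
  span-swap₁₂ w x y z = trans (span-values w x y z (adj-swap₁₂ w x y) (adj-swap₁₂ w x z) refl refl)
                                (swap₃₄ (adj x w y) (adj x w z) (adj w y z) (adj x y z))
    where
    swap₃₄ : ∀ a b c d → a + b + c + d ≡ a + b + d + c
    swap₃₄ = solve-∀

  span-swap₂₃ : ∀ w x y z → span w x y z ≡ span w y x z
  span-swap₂₃ w x y z = trans (span-values w x y z (adj-swap₂₃ w x y) refl refl (adj-swap₁₂ x y z))
                                (swap₂₃ (adj w y x) (adj w x z) (adj w y z) (adj y x z))
    where
    swap₂₃ : ∀ a b c d → a + b + c + d ≡ a + c + b + d
    swap₂₃ = solve-∀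

  span-swap₃₄ : ∀ w x y z → span w x y z ≡ span w x z y
  span-swap₃₄ w x y z = trans (span-values w x y z refl refl (adj-swap₂₃ w y z) (adj-swap₂₃ x y z))
                                (swap₁₂ (adj w x y) (adj w x z) (adj w z y) (adj x z y))
    where
    swap₁₂ : ∀ a b c d → a + b + c + d ≡ b + a + c + d
    swap₁₂ = solve-∀

  span≢0₁ : ∀ {w x y z} → adj w x y ≡ 1 → span w x y z ≢ 0
  span≢0₁ {w} {x} {y} {z} wxy≡1 span≡0 =
    0≢1+n (trans (sym (m+n≡0⇒m≡0 (adj w x y) (m+n≡0⇒m≡0 (adj w x y + adj w x z)
                                (m+n≡0⇒m≡0 (adj w x y + adj w x z + adj w y z) span≡0)))) wxy≡1)

  span≢0₂ : ∀ {w x y z} → adj w x z ≡ 1 → span w x y z ≢ 0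
  span≢0₂ {w} {x} {y} {z} wxz≡1 span≡0 =
    0≢1+n (trans (sym (m+n≡0⇒n≡0 (adj w x y) (m+n≡0⇒m≡0 (adj w x y + adj w x z)
                                (m+n≡0⇒m≡0 (adj w x y + adj w x z + adj w y z) span≡0)))) wxz≡1)

  edgesIn₅ : Fin n → Fin n → Fin n → Fin n → Fin n → ℕ
  edgesIn₅ v₁ v₂ v₃ v₄ v₅ = adj v₁ v₂ v₃ + adj v₁ v₂ v₄ + adj v₁ v₂ v₅ + adj v₁ v₃ v₄ + adj v₁ v₃ v₅ +
                            adj v₁ v₄ v₅ + adj v₂ v₃ v₄ + adj v₂ v₃ v₅ + adj v₂ v₄ v₅ + adj v₃ v₄ v₅

  four-subsets-double-count : ∀ v₁ v₂ v₃ v₄ v₅ →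
    span v₁ v₂ v₃ v₄ + span v₁ v₂ v₃ v₅ + span v₁ v₂ v₄ v₅ + span v₁ v₃ v₄ v₅ + span v₂ v₃ v₄ v₅ ≡
    2 * edgesIn₅ v₁ v₂ v₃ v₄ v₅
  four-subsets-double-count v₁ v₂ v₃ v₄ v₅ =
    each-triple-twice (adj v₁ v₂ v₃) (adj v₁ v₂ v₄) (adj v₁ v₂ v₅) (adj v₁ v₃ v₄) (adj v₁ v₃ v₅)
                      (adj v₁ v₄ v₅) (adj v₂ v₃ v₄) (adj v₂ v₃ v₅) (adj v₂ v₄ v₅) (adj v₃ v₄ v₅)
    where
    each-triple-twice : ∀ a₁₂₃ a₁₂₄ a₁₂₅ a₁₃₄ a₁₃₅ a₁₄₅ a₂₃₄ a₂₃₅ a₂₄₅ a₃₄₅ →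
      (a₁₂₃ + a₁₂₄ + a₁₃₄ + a₂₃₄) + (a₁₂₃ + a₁₂₅ + a₁₃₅ + a₂₃₅) + (a₁₂₄ + a₁₂₅ + a₁₄₅ + a₂₄₅) +
      (a₁₃₄ + a₁₃₅ + a₁₄₅ + a₃₄₅) + (a₂₃₄ + a₂₃₅ + a₂₄₅ + a₃₄₅) ≡
      2 * (a₁₂₃ + a₁₂₄ + a₁₂₅ + a₁₃₄ + a₁₃₅ + a₁₄₅ + a₂₃₄ + a₂₃₅ + a₂₄₅ + a₃₄₅)
    each-triple-twice = solve-∀

  pairWeight : Fin n → Fin n → ℕ
  pairWeight x y = weight n (codegree x y)

  pairWeight-sym : ∀ x y → pairWeight x y ≡ pairWeight y x
  pairWeight-sym x y = cong (weight n) (codegree-sym x y)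

  ∑-codegree*pairWeight≤ : ∑[ x < n ] ∑[ y < n ] (codegree x y * pairWeight x y) ≤ n * ((n ∸ 1) * (n ∸ 2))
  ∑-codegree*pairWeight≤ =
    ∑-≤ _ λ x → ∑-≤-punctured _ (cong (_* pairWeight x x) (codegree-refl x))
                                λ y → *-weight-≤ n (codegree x y) (codegree≤n∸2 x y)

  opaque
    unfolding adj

    ∑-codegree*pairWeight : ∑[ x < n ] ∑[ y < n ] (codegree x y * pairWeight x y) ≡
                            ∑³ (λ x y z → sortedEdge x y z * symmetrize (λ x y _ → pairWeight x y) x y z)
    ∑-codegree*pairWeight =
      trans (sum-cong-≗ λ x → sum-cong-≗ λ y → *-distribʳ-sum (pairWeight x y) (adj x y))
            (∑³-symmetrize-* sortedEdge (λ x y _ → pairWeight x y))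

  module _ (free : Free-4-2-4-4 H) where

    span-allowed : ∀ w x y z → Distinct₄ w x y z → Allowed (span w x y z)
    span-allowed = wlog-sorted₄ (Finₚ.≤-totalOrder n) (λ w x y z → Distinct₄ w x y z → Allowed (span w x y z))
      (λ {w} {x} {y} {z} allowed (x≢w , x≢y , x≢z , w≢y , w≢z , y≢z) →
         subst Allowed (span-swap₁₂ w x y z) (allowed (≢-sym x≢w , w≢y , w≢z , x≢y , x≢z , y≢z)))
      (λ {w} {x} {y} {z} allowed (w≢y , w≢x , w≢z , y≢x , y≢z , x≢z) →
         subst Allowed (span-swap₂₃ w x y z) (allowed (w≢x , w≢y , w≢z , ≢-sym y≢x , x≢z , y≢z)))
      (λ {w} {x} {y} {z} allowed (w≢x , w≢z , w≢y , x≢z , x≢y , z≢y) →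
         subst Allowed (span-swap₃₄ w x y z) (allowed (w≢x , w≢y , w≢z , x≢y , x≢z , ≢-sym z≢y)))
      (λ {w} {x} {y} {z} w≤x x≤y y≤z (w≢x , _ , _ , x≢y , _ , y≢z) →
         let w<x = Finₚ.≤∧≢⇒< w≤x w≢x
             x<y = Finₚ.≤∧≢⇒< x≤y x≢y
             y<z = Finₚ.≤∧≢⇒< y≤z y≢z
         in subst Allowed (sym (span-sorted w<x x<y y<z)) (free w x y z w<x x<y y<z))

    span-odd : ∀ {w x y z} → Distinct₄ w x y z → span w x y z ≢ 0 → Odd (span w x y z)
    span-odd {w} {x} {y} {z} distinct span≢0 = allowed⇒odd (span≤4 w x y z) span≢0 (span-allowed w x y z distinct)

    five-set-has-empty-four-subset : ∀ {v₁ v₂ v₃ v₄ v₅} → Distinct₅ v₁ v₂ v₃ v₄ v₅ →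
      span v₁ v₂ v₃ v₄ ≢ 0 → span v₁ v₂ v₃ v₅ ≢ 0 → span v₁ v₂ v₄ v₅ ≢ 0 → span v₁ v₃ v₄ v₅ ≢ 0 →
      span v₂ v₃ v₄ v₅ ≢ 0 → ⊥
    five-set-has-empty-four-subset {v₁} {v₂} {v₃} {v₄} {v₅} (d₁₂ , d₁₃ , d₁₄ , d₁₅ , d₂₃ , d₂₄ , d₂₅ , d₃₄ , d₃₅ , d₄₅)
      s₁₂₃₄ s₁₂₃₅ s₁₂₄₅ s₁₃₄₅ s₂₃₄₅
      with odd-sum₅ (span-odd (d₁₂ , d₁₃ , d₁₄ , d₂₃ , d₂₄ , d₃₄) s₁₂₃₄)
                    (span-odd (d₁₂ , d₁₃ , d₁₅ , d₂₃ , d₂₅ , d₃₅) s₁₂₃₅)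
                    (span-odd (d₁₂ , d₁₄ , d₁₅ , d₂₄ , d₂₅ , d₄₅) s₁₂₄₅)
                    (span-odd (d₁₃ , d₁₄ , d₁₅ , d₃₄ , d₃₅ , d₄₅) s₁₃₄₅)
                    (span-odd (d₂₃ , d₂₄ , d₂₅ , d₃₄ , d₃₅ , d₄₅) s₂₃₄₅)
    ... | t , odd = even≢odd (edgesIn₅ v₁ v₂ v₃ v₄ v₅) t (trans (sym (four-subsets-double-count v₁ v₂ v₃ v₄ v₅)) odd)

    third-edge : ∀ {w x y z} → Distinct₄ w x y z → adj w x y ≡ 1 → adj w x z ≡ 1 →
                 (adj w y z ≡ 1 × adj x y z ≡ 0) ⊎ (adj w y z ≡ 0 × adj x y z ≡ 1)
    third-edge {w} {x} {y} {z} distinct wxy wxz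
      with span-allowed w x y z distinct | adj≡0⊎adj≡1 w y z | adj≡0⊎adj≡1 x y z
    ... | span≢2 , _ | inj₁ wyz | inj₁ xyz = ⊥-elim (span≢2 (span-values w x y z wxy wxz wyz xyz))
    ... | _          | inj₁ wyz | inj₂ xyz = inj₂ (wyz , xyz)
    ... | _          | inj₂ wyz | inj₁ xyz = inj₁ (wyz , xyz)
    ... | _ , span≢4 | inj₂ wyz | inj₂ xyz = ⊥-elim (span≢4 (span-values w x y z wxy wxz wyz xyz))

    -- A second edge ija on the pair ij makes {i,j,k,a} span exactly three edges; say ika is the third.
    -- A second edge jkc on the pair jk then yields a 5-set {i,j,k,a,c} every 4-subset of which spans an edge.
    edge-has-codegree-one-pair : ∀ {i j k} → adj i j k ≡ 1 →
                                 codegree i j ≡ 1 ⊎ codegree i k ≡ 1 ⊎ codegree j k ≡ 1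
    edge-has-codegree-one-pair {i} {j} {k} ijk
      with codegree i j ≟ 1 | codegree i k ≟ 1 | codegree j k ≟ 1
    ... | yes ij≡1 | _        | _        = inj₁ ij≡1
    ... | no _     | yes ik≡1 | _        = inj₂ (inj₁ ik≡1)
    ... | no _     | no _     | yes jk≡1 = inj₂ (inj₂ jk≡1)
    ... | no ij≢1  | no ik≢1  | no jk≢1
      with other-neighbour ij≢1 ijk
    ... | a , a≢k , ija
      with adj≡1⇒distinct ijk | adj≡1⇒distinct ija
    ... | i≢j , i≢k , j≢k | _ , i≢a , j≢a
      with third-edge (i≢j , i≢k , i≢a , j≢k , j≢a , ≢-sym a≢k) ijk ija
    ... | inj₁ (ika , jka≡0) =
      let c , c≢i , jkc = other-neighbour jk≢1 (trans (sym (trans (adj-swap₁₂ i j k) (adj-swap₂₃ j i k))) ijk)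
          _ , j≢c , k≢c = adj≡1⇒distinct jkc
          a≢c : a ≢ c
          a≢c = λ { refl → 0≢1+n (trans (sym jka≡0) jkc) }
      in ⊥-elim (five-set-has-empty-four-subset
           (i≢j , i≢k , i≢a , ≢-sym c≢i , j≢k , j≢a , j≢c , ≢-sym a≢k , k≢c , a≢c)
           (span≢0₁ ijk) (span≢0₁ ijk) (span≢0₁ ija) (span≢0₁ ika) (span≢0₂ jkc))
    ... | inj₂ (ika≡0 , jka) =
      let b , b≢j , ikb = other-neighbour ik≢1 (trans (sym (adj-swap₂₃ i j k)) ijk)
          _ , i≢b , k≢b = adj≡1⇒distinct ikb
          a≢b : a ≢ b
          a≢b = λ { refl → 0≢1+n (trans (sym ika≡0) ikb) }
      in ⊥-elim (five-set-has-empty-four-subset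
           (i≢j , i≢k , i≢a , i≢b , j≢k , j≢a , ≢-sym b≢j , ≢-sym a≢k , k≢b , a≢b)
           (span≢0₁ ijk) (span≢0₁ ijk) (span≢0₁ ija) (span≢0₂ ikb) (span≢0₁ jka))

    pairWeights-≥ : ∀ {x y z} → x < y → y < z → adj x y z ≡ 1 →
                    2 * n ≤ symmetrize (λ x y _ → pairWeight x y) x y z
    pairWeights-≥ {x} {y} {z} x<y y<z xyz≡1 = begin
      2 * n                                                   ≤⟨ *-monoʳ-≤ 2 n≤ ⟩
      2 * (pairWeight x y + pairWeight x z + pairWeight y z)  ≡⟨ symmetrize-sym₂ pairWeight pairWeight-sym x y z ⟨
      symmetrize (λ x y _ → pairWeight x y) x y z             ∎
      where
      open ≤-Reasoning
      n≤ : n ≤ pairWeight x y + pairWeight x z + pairWeight y z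
      n≤ = weight-sum-≥ (<-<⇒3≤n x<y y<z) (edge-has-codegree-one-pair xyz≡1)

    sortedEdge*2n≤ : ∀ x y z → sortedEdge x y z * (2 * n) ≤
                               sortedEdge x y z * symmetrize (λ x y _ → pairWeight x y) x y z
    sortedEdge*2n≤ x y z with sortedEdge x y z ≟ 0
    ... | yes xyz≡0 rewrite xyz≡0 = z≤n
    ... | no  xyz≢0 =
      let x<y , y<z = sortedEdge≢0⇒sorted xyz≢0
          adj≢0 : adj x y z ≢ 0
          adj≢0 = λ adj≡0 → xyz≢0 (trans (sortedEdge-sorted x<y y<z) (trans (sym (adj-sorted x<y y<z)) adj≡0))
      in *-monoʳ-≤ (sortedEdge x y z) (pairWeights-≥ x<y y<z (adj≢0⇒adj≡1 adj≢0))

    double-counting : n * (2 * numEdges H) ≤ n * ((n ∸ 1) * (n ∸ 2))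
    double-counting = begin
      n * (2 * numEdges H)                          ≡⟨ cong (λ e → n * (2 * e)) numEdges≡∑³sortedEdge ⟩
      n * (2 * ∑³ sortedEdge)                       ≡⟨ rearrange n (∑³ sortedEdge) ⟩
      ∑³ sortedEdge * (2 * n)                       ≡⟨ ∑³-*ʳ sortedEdge (2 * n) ⟩
      ∑³ (λ x y z → sortedEdge x y z * (2 * n))     ≤⟨ ∑³-mono-≤ sortedEdge*2n≤ ⟩
      ∑³ (λ x y z → sortedEdge x y z * symmetrize (λ x y _ → pairWeight x y) x y z)
                                                    ≡⟨ ∑-codegree*pairWeight ⟨
      ∑[ x < n ] ∑[ y < n ] (codegree x y * pairWeight x y)
                                                    ≤⟨ ∑-codegree*pairWeight≤ ⟩
      n * ((n ∸ 1) * (n ∸ 2))                       ∎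
      where
      open ≤-Reasoning
      rearrange : ∀ n e → n * (2 * e) ≡ e * (2 * n)
      rearrange = solve-∀

proposition4p3 : (n : ℕ) (H : ThreeGraph n) → Free-4-2-4-4 H →
    numEdges H ≤ (n ∸ 1) C 2
proposition4p3 zero    H free = z≤n
proposition4p3 (suc n) H free = *-cancelˡ-≤ 2 (begin
  2 * numEdges H    ≤⟨ *-cancelˡ-≤ (suc n) (double-counting H free) ⟩
  n * (n ∸ 1)       ≡⟨ 2*[nC2]≡n*[n∸1] n ⟨
  2 * (n C 2)       ∎)
  where open ≤-Reasoning
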